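{- Let $s\in\{2,10,14,22\}$ (so that $\gcd(48,s)=2$). Then each of the following pairs of circulant graphs is a pair of Type-2 isomorphic circulant graphs with respect to $m=2$: (h) $C_{48}(1,s,23)$ and $C_{48}(s,11,13)$; (i) $C_{48}(3,s,21)$ and $C_{48}(s,9,15)$; (j) $C_{48}(5,s,19)$ and $C_{48}(s,7,17)$.
   Context: For an integer $n\ge 2$ and a set $R\subseteq\{1,\dots,\lfloor n/2\rfloor\}$, the circulant graph $C_n(R)$ has vertex set $\{v_0,\dots,v_{n-1}\}$ (indices modulo $n$), and $v_iv_j$ is an edge iff $i-j\equiv \pm r \pmod n$ for some $r\in R$; we write $C_n(a,b,c)$ for $C_n(\{a,b,c\})$, etc. The reflexive modular reduction of a collection of integers reduces each modulo $n$ to $r'\in\{0,\dots,n-1\}$ and then replaces $r'$ by $n-r'$ whenever $r'>n/2$. For $x$ with $\gcd(n,x)=1$, $xR$ denotes the reflexive modular reduction of $\{xr: r\in R\}$. Given $m>1$ and $0\le t\le n/m-1$, the map $\theta_{n,m,t}$ sends the vertex $v_x$ ($x\in\mathbb{Z}_n$, written $x=qm+j$ with $0\le j\le m-1$) to $u_{x+jtm}$ (subscripts modulo $n$, where $u_0,\dots,u_{n-1}$ are the vertices of $K_n$) and an edge $(v_x,v_{x+s})$ to $(\theta_{n,m,t}(v_x),\theta_{n,m,t}(v_{x+s}))$. Two circulant graphs $C_n(R)$ and $C_n(S)$ are called Type-2 isomorphic with respect to $m$ if: $R\neq S$ and $|R|=|S|\ge 3$; there is $r\in R\cap S$ with $m\mid\gcd(n,r)$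 and $m^3\mid n$; there is $t$ with $1\le t\le n/m-1$ such that $\theta_{n,m,t}$ maps the edge set of $C_n(R)$ exactly onto the edge set of $C_n(S)$ (i.e. $\theta_{n,m,t}(C_n(R))=C_n(S)$); and $S\neq xR$ for every $x$ with $\gcd(x,n)=1$. By convention, if $C_n(R)$ and $C_n(S)$ are Type-2 isomorphic with respect to $m$, then for every positive integer $k$ the graphs $C_{kn}(kR)$ and $C_{kn}(kS)$, where $kR=\{kr:r\in R\}$, are also said to be Type-2 isomorphic with respect to $m$. -}

module Defs where

open import Data.Nat using (ℕ; zero; suc; _+_; _*_; _∸_; _^_; _≤_; _<_; _≥_)
open import Data.Nat.DivMod using (_%_)
open import Data.Nat.Divisibility using (_∣_)
open import Data.Nat.GCD using (gcd)
open import Data.Nat.Coprimality using (Coprime)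
open import Data.List using (List; map; length)
open import Data.List.Membership.Propositional using (_∈_)
open import Data.List.Relation.Unary.All using (All)
open import Data.List.Relation.Unary.Unique.Propositional using (Unique)
open import Data.Product using (Σ; ∃; _×_; _,_)
open import Data.Sum using (_⊎_)
open import Relation.Nullary using (¬_)
open import Relation.Binary.PropositionalEquality using (_≡_)
open import Function.Bundles using (_⇔_)
open import Data.Bool using (if_then_else_)
open import Relation.Nullary.Decidable using (⌊_⌋)
open import Data.Nat using (_<?_)

-- a modulo n, with the convention a mod 0 = a (never used with n = 0)
_mod_ : ℕ → ℕ → ℕ
a mod zero    = a
a mod (suc k) = a % suc k

-- A set of integers is represented by a duplicate-free list.
-- Set equality of two lists.
_≈ₛ_ : List ℕ → List ℕ → Set
R ≈ₛ S = ∀ z → (z ∈ R) ⇔ (z ∈ S)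

-- R is an admissible connection set for C_n(R):
-- duplicate-free, and R ⊆ {1, …, ⌊n/2⌋}  (r ≤ ⌊n/2⌋ ⇔ 2r ≤ n)
ValidConn : ℕ → List ℕ → Set
ValidConn n R = Unique R × All (λ r → 1 ≤ r × 2 * r ≤ n) R

Adj : ℕ → List ℕ → ℕ → ℕ → Set
Adj n R a b = a < n × b < n ×
  ∃ λ r → r ∈ R × ((a ≡ (b + r) mod n) ⊎ (b ≡ (a + r) mod n))

reflRed : ℕ → ℕ → ℕ
reflRed n r = let r′ = r mod n in
  if ⌊ n <? 2 * r′ ⌋ then n ∸ r′ else r′

scaleRed : ℕ → ℕ → List ℕ → List ℕ
scaleRed n x R = map (λ r → reflRed n (x * r)) R

θ : ℕ → ℕ → ℕ → ℕ → ℕ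
θ n m t x = (x + (x mod m) * t * m) mod n

-- θ_{n,m,t} maps the edge set of C_n(R) exactly onto that of C_n(S)
-- (adjacency is symmetric, so ordered pairs suffice)
MapsOnto : ℕ → ℕ → ℕ → List ℕ → List ℕ → Set
MapsOnto n m t R S = ∀ a b →
  Adj n S a b ⇔ (∃ λ x → ∃ λ y → Adj n R x y × θ n m t x ≡ a × θ n m t y ≡ b)

Type2Base : ℕ → ℕ → List ℕ → List ℕ → Set
Type2Base n m R S =
  2 ≤ n × 1 < m × ValidConn n R × ValidConn n S ×
  ¬ (R ≈ₛ S) × length R ≡ length S × 3 ≤ length R ×
  (∃ λ r → r ∈ R × r ∈ S × m ∣ gcd n r) × (m ^ 3) ∣ n ×
  (∃ λ t → 1 ≤ t × t * m + m ≤ n × MapsOnto n m t R S) ×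
  (∀ x → Coprime x n → ¬ (S ≈ₛ scaleRed n x R))

-- Including the convention: C_{kn}(kR), C_{kn}(kS) are Type-2 isomorphic
-- whenever C_n(R), C_n(S) are.
Type2Iso : ℕ → ℕ → List ℕ → List ℕ → Set
Type2Iso N m R S = ∃ λ k → ∃ λ n → ∃ λ R₀ → ∃ λ S₀ →
  1 ≤ k × N ≡ k * n × R ≈ₛ map (k *_) R₀ × S ≈ₛ map (k *_) S₀ ×
  Type2Base n m R₀ S₀

{-# OPTIONS --safe #-}
module Submission where

-- θ_{48,2,6} fixes the even vertices and moves each odd vertex by 12, so an edge of odd
-- jump r becomes an edge of jump r + 12 at an even endpoint and of jump r − 12 at an odd
-- one, while the even jump s is kept; the pairs {1,23}, {3,21}, {5,19} are thereby
-- traded for {11,13}, {9,15}, {7,17}.  Once the witnesses t = 6 and r = s are fixed,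
-- every condition of a Type-2 isomorphism is a finite check over ℤ₄₈ (the multipliers x
-- only matter modulo 48), so each of the twelve instances is decided by evaluation.

open import Defs
open import Data.Bool using (if_then_else_)
open import Data.Nat using (ℕ; zero; suc; _+_; _*_; _∸_; _^_; _≤_; _<_; s≤s; z≤n; _≟_; _≤?_; _<?_)
open import Data.Nat.Properties using (allUpTo?; anyUpTo?; *-identityˡ)
open import Data.Nat.DivMod using (_%_; %-distribˡ-*; m%n%n≡m%n; m%n<n)
open import Data.Nat.Divisibility using (_∣_; _∣?_)
open import Data.Nat.GCD using (gcd)
open import Data.List using (List; _∷_; []; map; length)
open import Data.List.Properties using (map-cong; map-id)
open import Data.List.Membership.Propositional using (_∈_; find; lose)
open import Data.List.Membership.DecPropositional _≟_ using (_∈?_)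
open import Data.List.Relation.Binary.Subset.Propositional using (_⊆_)
open import Data.List.Relation.Binary.Subset.DecPropositional _≟_ using (_⊆?_)
open import Data.List.Relation.Unary.All using (all?)
open import Data.List.Relation.Unary.Any using (any?)
open import Data.List.Relation.Unary.Unique.DecPropositional _≟_ using (unique?)
open import Data.Product using (_×_; _,_; ∃)
open import Data.Sum using (_⊎_; inj₁; inj₂)
open import Function.Bundles using (_⇔_; mk⇔; Equivalence)
import Function.Properties.Equivalence as ⇔
open import Relation.Nullary using (¬_; Dec; ¬?)
open import Relation.Nullary.Decidable
  using (⌊_⌋; True; toWitness; map′; _×-dec_; _⊎-dec_; _→-dec_)
open import Relation.Binary.PropositionalEquality
  using (_≡_; refl; sym; trans; cong; subst; module ≡-Reasoning)

PreservesAdjacency : (ℕ → ℕ) → ℕ → List ℕ → List ℕ → Set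
PreservesAdjacency f n R S =
  ∀ {x} → x < n → ∀ {y} → y < n → Adj n R x y ⇔ Adj n S (f x) (f y)

SurjectiveBelow : (ℕ → ℕ) → ℕ → Set
SurjectiveBelow f n = ∀ {a} → a < n → ∃ λ x → x < n × f x ≡ a

mapsOnto : ∀ {n m t R S} →
  PreservesAdjacency (θ n m t) n R S → SurjectiveBelow (θ n m t) n → MapsOnto n m t R S
mapsOnto {n} {m} {t} {R} {S} preserves surjective a b = mk⇔ pullBack pushForward
  where
  pullBack : Adj n S a b → ∃ λ x → ∃ λ y → Adj n R x y × θ n m t x ≡ a × θ n m t y ≡ b
  pullBack adj@(a<n , b<n , _) with surjective a<n | surjective b<n
  ... | x , x<n , refl | y , y<n , refl =
    x , y , Equivalence.from (preserves x<n y<n) adj , refl , refl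
  pushForward : (∃ λ x → ∃ λ y → Adj n R x y × θ n m t x ≡ a × θ n m t y ≡ b) → Adj n S a b
  pushForward (x , y , adj@(x<n , y<n , _) , refl , refl) = Equivalence.to (preserves x<n y<n) adj

scaleRed-mod : ∀ n x R → scaleRed n x R ≡ scaleRed n (x mod n) R
scaleRed-mod zero      x R = refl
scaleRed-mod n@(suc _) x R = map-cong (λ r → reflRed-cong (x * r) ((x % n) * r) (*-mod r)) R
  where
  open ≡-Reasoning
  reflRed-cong : ∀ w w′ → w mod n ≡ w′ mod n → reflRed n w ≡ reflRed n w′
  reflRed-cong _ _ = cong (λ r′ → if ⌊ n <? 2 * r′ ⌋ then n ∸ r′ else r′)
  *-mod : ∀ r → (x * r) % n ≡ ((x % n) * r) % n
  *-mod r = begin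
    (x * r) % n                  ≡⟨ %-distribˡ-* x r n ⟩
    ((x % n) * (r % n)) % n      ≡⟨ cong (λ u → (u * (r % n)) % n) (sym (m%n%n≡m%n x n)) ⟩
    ((x % n % n) * (r % n)) % n  ≡⟨ sym (%-distribˡ-* (x % n) r n) ⟩
    ((x % n) * r) % n            ∎

noScalingBelow⇒noScaling : ∀ {k R S} →
  (∀ {x} → x < suc k → ¬ (S ≈ₛ scaleRed (suc k) x R)) → ∀ x → ¬ (S ≈ₛ scaleRed (suc k) x R)
noScalingBelow⇒noScaling {k} {R} {S} noScalingBelow x =
  subst (λ L → ¬ (S ≈ₛ L)) (sym (scaleRed-mod (suc k) x R)) (noScalingBelow (m%n<n x (suc k)))

type2Base⇒type2Iso : ∀ {n m R S} → Type2Base n m R S → Type2Iso n m R S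
type2Base⇒type2Iso {n} {m} {R} {S} base =
  1 , n , R , S , s≤s z≤n , sym (*-identityˡ n) , ≈ₛ-map-1* R , ≈ₛ-map-1* S , base
  where
  ≈ₛ-map-1* : ∀ L → L ≈ₛ map (1 *_) L
  ≈ₛ-map-1* L _ rewrite trans (map-cong *-identityˡ L) (map-id L) = ⇔.refl

_⇔-dec_ : {A B : Set} → Dec A → Dec B → Dec (A ⇔ B)
a? ⇔-dec b? = map′ (λ (to , from) → mk⇔ to from)
                   (λ A⇔B → Equivalence.to A⇔B , Equivalence.from A⇔B)
                   ((a? →-dec b?) ×-dec (b? →-dec a?))

_≈ₛ?_ : (R S : List ℕ) → Dec (R ≈ₛ S)
R ≈ₛ? S = map′ ⊆⇒≈ₛ ≈ₛ⇒⊆ (R ⊆? S ×-dec S ⊆? R)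
  where
  ⊆⇒≈ₛ : R ⊆ S × S ⊆ R → R ≈ₛ S
  ⊆⇒≈ₛ (R⊆S , S⊆R) _ = mk⇔ R⊆S S⊆R
  ≈ₛ⇒⊆ : R ≈ₛ S → R ⊆ S × S ⊆ R
  ≈ₛ⇒⊆ R≈S = Equivalence.to (R≈S _) , Equivalence.from (R≈S _)

validConn? : ∀ n R → Dec (ValidConn n R)
validConn? n R = unique? R ×-dec all? (λ r → 1 ≤? r ×-dec 2 * r ≤? n) R

adj? : ∀ n R a b → Dec (Adj n R a b)
adj? n R a b = a <? n ×-dec b <? n ×-dec
  map′ find (λ (_ , r∈R , e) → lose r∈R e)
       (any? (λ r → a ≟ (b + r) mod n ⊎-dec b ≟ (a + r) mod n) R)

preservesAdjacency? : ∀ f n R S → Dec (PreservesAdjacency f n R S)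
preservesAdjacency? f n R S =
  allUpTo? (λ x → allUpTo? (λ y → adj? n R x y ⇔-dec adj? n S (f x) (f y)) n) n

surjectiveBelow? : ∀ f n → Dec (SurjectiveBelow f n)
surjectiveBelow? f n = allUpTo? (λ a → anyUpTo? (λ x → f x ≟ a) n) n

-- Type2Base with its two existential witnesses t and r supplied, and with the
-- multipliers ranging over the residues below n instead of over the coprime naturals.
Type2Certificate : (n m t r : ℕ) → List ℕ → List ℕ → Set
Type2Certificate n m t r R S =
  2 ≤ n × 1 < m × ValidConn n R × ValidConn n S ×
  ¬ (R ≈ₛ S) × length R ≡ length S × 3 ≤ length R ×
  (r ∈ R × r ∈ S × m ∣ gcd n r) × (m ^ 3) ∣ n ×
  (1 ≤ t × t * m + m ≤ n × PreservesAdjacency (θ n m t) n R S × SurjectiveBelow (θ n m t) n) ×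
  (∀ {x} → x < n → ¬ (S ≈ₛ scaleRed n x R))

type2Certificate? : ∀ n m t r R S → Dec (Type2Certificate n m t r R S)
type2Certificate? n m t r R S =
  2 ≤? n ×-dec 1 <? m ×-dec validConn? n R ×-dec validConn? n S ×-dec
  ¬? (R ≈ₛ? S) ×-dec length R ≟ length S ×-dec 3 ≤? length R ×-dec
  (r ∈? R ×-dec r ∈? S ×-dec m ∣? gcd n r) ×-dec (m ^ 3) ∣? n ×-dec
  (1 ≤? t ×-dec t * m + m ≤? n ×-dec
   preservesAdjacency? (θ n m t) n R S ×-dec surjectiveBelow? (θ n m t) n) ×-dec
  allUpTo? (λ x → ¬? (S ≈ₛ? scaleRed n x R)) n

certificate⇒type2Base : ∀ {n m t r R S} → Type2Certificate n m t r R S → Type2Base n m R S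
certificate⇒type2Base {m = m} {t} {r}
  (2≤n@(s≤s _) , 1<m , validR , validS , R≉S , |R|≡|S| , 3≤|R| , (r∈R , r∈S , m∣gcd) , m³∣n ,
   (1≤t , t-bound , preserves , surjective) , noScalingBelow) =
  2≤n , 1<m , validR , validS , R≉S , |R|≡|S| , 3≤|R| , (r , r∈R , r∈S , m∣gcd) , m³∣n ,
  (t , 1≤t , t-bound , mapsOnto {m = m} preserves surjective) ,
  λ x _ → noScalingBelow⇒noScaling noScalingBelow x

certified : ∀ {n m} t r {R S} → {checked : True (type2Certificate? n m t r R S)} → Type2Iso n m R S
certified t r {checked = checked} = type2Base⇒type2Iso (certificate⇒type2Base (toWitness checked))

mainTheorem1 : (s : ℕ) → (s ≡ 2 ⊎ s ≡ 10 ⊎ s ≡ 14 ⊎ s ≡ 22) →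
    Type2Iso 48 2 (1 ∷ s ∷ 23 ∷ []) (s ∷ 11 ∷ 13 ∷ []) ×
    Type2Iso 48 2 (3 ∷ s ∷ 21 ∷ []) (s ∷ 9 ∷ 15 ∷ []) ×
    Type2Iso 48 2 (5 ∷ s ∷ 19 ∷ []) (s ∷ 7 ∷ 17 ∷ [])
mainTheorem1 _ (inj₁ refl)               = certified 6 2 , certified 6 2 , certified 6 2
mainTheorem1 _ (inj₂ (inj₁ refl))        = certified 6 10 , certified 6 10 , certified 6 10
mainTheorem1 _ (inj₂ (inj₂ (inj₁ refl))) = certified 6 14 , certified 6 14 , certified 6 14
mainTheorem1 _ (inj₂ (inj₂ (inj₂ refl))) = certified 6 22 , certified 6 22 , certified 6 22
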